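{- Let $T$ be a tree and $\bar T$ its complement. Then $g_2(\bar T)=3$ if $\mathrm{diam}(T)=3$ and $T$ has a vertex of degree two; $g_2(\bar T)=4$ if $\mathrm{diam}(T)=3$ and $T$ has no vertex of degree two; and $g_2(\bar T)=g(\bar T)$ otherwise.
   Context: For a graph $G$ and $S\subseteq V(G)$, $I(S)$ is the set of vertices lying on some shortest $u,v$-path with $u,v\in S$; $S$ is geodetic if $I(S)=V(G)$ and $g(G)$ is the minimum size of a geodetic set. A geodetic set $S$ is $2$-geodetic if every vertex of $V(G)\setminus S$ has two nonadjacent neighbors in $S$; $g_2(G)$ is the minimum size of a $2$-geodetic set. $\mathrm{diam}(T)$ is the diameter of $T$. -}

module Defs where

open import Data.Nat using (ℕ; zero; suc; _+_; _≤_)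
open import Data.Bool using (Bool; true; false; not; _∧_)
open import Data.Fin using (Fin; zero; suc; inject₁; fromℕ; _≟_)
open import Data.Fin.Subset using (Subset; _∈_; _∉_; ∣_∣)
open import Data.Vec using (tabulate)
open import Data.Product using (Σ; ∃; ∃-syntax; _×_; _,_)
open import Relation.Binary.PropositionalEquality using (_≡_; _≢_)
open import Relation.Nullary using (¬_)
open import Relation.Nullary.Decidable using (⌊_⌋)
open import Function.Definitions using (Injective)

record Graph (n : ℕ) : Set where
  field
    adj    : Fin n → Fin n → Bool
    adj-sym    : ∀ u v → adj u v ≡ adj v u
    adj-irrefl : ∀ v → adj v v ≡ false
open Graph public

module _ {n : ℕ} (G : Graph n) where

  Adj : Fin n → Fin n → Set
  Adj u v = adj G u v ≡ true

  data Walk : Fin n → Fin n → Set where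
    [_] : (v : Fin n) → Walk v v
    _∷_ : ∀ {u v w} → Adj u v → Walk v w → Walk u w

  len : ∀ {u v} → Walk u v → ℕ
  len [ v ]    = 0
  len (_ ∷ p)  = suc (len p)

  data OnWalk (w : Fin n) : ∀ {u v} → Walk u v → Set where
    here-[] : OnWalk w [ w ]
    here-∷  : ∀ {v x} (e : Adj w v) (p : Walk v x) → OnWalk w (e ∷ p)
    there   : ∀ {u v x} (e : Adj u v) {p : Walk v x} → OnWalk w p → OnWalk w (e ∷ p)

  Geodesic : ∀ {u v} → Walk u v → Set
  Geodesic {u} {v} p = ∀ (q : Walk u v) → len p ≤ len q

  Dist : Fin n → Fin n → ℕ → Set
  Dist u v d = Σ (Walk u v) λ p → Geodesic p × len p ≡ d

  Connected : Set
  Connected = ∀ u v → Walk u v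

  HasCycle : Set
  HasCycle = ∃[ k ] Σ (Fin (suc (suc (suc k))) → Fin n) λ f →
    Injective _≡_ _≡_ f ×
    (∀ (i : Fin (suc (suc k))) → Adj (f (inject₁ i)) (f (suc i))) ×
    Adj (f (fromℕ (suc (suc k)))) (f zero)

  Diameter : ℕ → Set
  Diameter d = (∀ u v → ∃[ e ] (Dist u v e × e ≤ d)) × (∃[ u ] ∃[ v ] Dist u v d)

  degree : Fin n → ℕ
  degree v = ∣ tabulate (adj G v) ∣

  Interval : Subset n → Fin n → Set
  Interval S w = ∃[ u ] ∃[ v ] (u ∈ S × v ∈ S ×
                   Σ (Walk u v) λ p → Geodesic p × OnWalk w p)

  Geodetic : Subset n → Set
  Geodetic S = ∀ w → Interval S w

  TwoGeodetic : Subset n → Set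
  TwoGeodetic S = Geodetic S ×
    (∀ w → w ∉ S → ∃[ a ] ∃[ b ] (a ∈ S × b ∈ S × Adj w a × Adj w b × a ≢ b × ¬ Adj a b))

  GeodeticNumber : ℕ → Set
  GeodeticNumber k = (∃[ S ] (Geodetic S × ∣ S ∣ ≡ k)) × (∀ S → Geodetic S → k ≤ ∣ S ∣)

  TwoGeodeticNumber : ℕ → Set
  TwoGeodeticNumber k = (∃[ S ] (TwoGeodetic S × ∣ S ∣ ≡ k)) × (∀ S → TwoGeodetic S → k ≤ ∣ S ∣)

IsTree : ∀ {n} → Graph n → Set
IsTree {n} G = 1 ≤ n × Connected G × ¬ HasCycle G

complement : ∀ {n} → Graph n → Graph n
complement {n} G = record
  { adj = λ u v → not (adj G u v) ∧ not ⌊ u ≟ v ⌋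
  ; adj-sym = symC
  ; adj-irrefl = irrC }
  where
  open import Relation.Binary.PropositionalEquality using (refl; cong₂; sym)
  open import Relation.Nullary using (yes; no)
  symC : ∀ u v → (not (adj G u v) ∧ not ⌊ u ≟ v ⌋) ≡ (not (adj G v u) ∧ not ⌊ v ≟ u ⌋)
  symC u v with u ≟ v | v ≟ u
  ... | yes _ | yes _ = cong₂ _∧_ (Relation.Binary.PropositionalEquality.cong not (Graph.adj-sym G u v)) refl
  ... | no _  | no _  = cong₂ _∧_ (Relation.Binary.PropositionalEquality.cong not (Graph.adj-sym G u v)) refl
  ... | yes p | no q  = Data.Empty.⊥-elim (q (sym p))
    where import Data.Empty
  ... | no q  | yes p = Data.Empty.⊥-elim (q (sym p))
    where import Data.Empty
  irrC : ∀ v → (not (adj G v v) ∧ not ⌊ v ≟ v ⌋) ≡ false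
  irrC v with v ≟ v
  ... | yes _ = Data.Bool.Properties.∧-zeroʳ (not (adj G v v))
    where import Data.Bool.Properties
  ... | no q = Data.Empty.⊥-elim (q refl)
    where import Data.Empty

-- A tree of diameter 3 is a double star: an edge ab such that every other vertex is a leaf at a or at b.
-- In the complement, a and b lie in every 2-geodetic set S, and a leaf at b outside S can only be flanked
-- by a together with a leaf at a.  Hence S contains a third vertex, and a fourth one when both centres
-- carry two leaves.  These bounds are attained by {a, b, p} when p is the only leaf at a, and otherwise
-- by {a, b, p, q} for leaves p at a and q at b.
-- If the diameter is not 3, the complement has no geodesic u x y z …, since T would then be a double star
-- with centres u and z.  With all geodesics of length at most 2, both geodetic and 2-geodetic sets are
-- exactly the sets flanking every vertex outside them, so g and g₂ coincide.

module Submission where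

open import Defs
open import Data.Nat using (ℕ; zero; suc; _+_; _≤_; z≤n; s≤s)
open import Data.Nat.Properties using (≤-trans; ≤-antisym; ≤-reflexive; +-mono-≤; +-monoʳ-≤; n≤1+n; +-suc; +-comm; +-identityʳ; <⇒≱; ≤∧≢⇒<; m<n+m)
import Data.Nat.Properties as ℕ
open import Data.Fin using (Fin; zero; suc; inject₁; fromℕ; _≟_)
open import Data.Fin.Subset using (Subset; _∈_; _∉_; ∣_∣; ⁅_⁆; _∪_; _⊆_; inside; outside) renaming (⊥ to ∅; ⊤ to full)
open import Data.Fin.Subset.Properties using (x∈⁅x⁆; x∈p∪q⁺; x∈p∧x≢y⇒x∈p-y; x∈p⇒∣p-x∣<∣p∣; p⊆q⇒∣p∣≤∣q∣; ∣⁅x⁆∣≡1; ∣⊥∣≡0; _∈?_; anySubset?; ∈⊤)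
open import Data.Fin.Properties using (any?; all?)
open import Data.Bool using (true; false; not; _∧_)
import Data.Bool.Properties as Bool
open import Data.Vec using (Vec; lookup; tabulate)
import Data.Vec as Vec
open import Data.Vec.Properties using (lookup∘tabulate; []=⇒lookup; lookup⇒[]=)
open import Data.List using (List; []; _∷_; length; foldr)
open import Data.List.Relation.Unary.All using (All; []; _∷_)
import Data.List.Relation.Unary.All as All
open import Data.List.Relation.Unary.Any using (here; there)
open import Data.List.Membership.Propositional using () renaming (_∈_ to _∈ˡ_)
open import Data.List.Relation.Unary.Unique.Propositional using (Unique)
open import Data.List.Relation.Unary.AllPairs using ([]; _∷_)
open import Data.Product using (Σ; ∃-syntax; _×_; _,_; proj₁; proj₂)
import Data.Product as Product
open import Data.Sum using (_⊎_; inj₁; inj₂)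
open import Data.Empty using (⊥; ⊥-elim)
open import Data.Unit using (tt) renaming (⊤ to Unit)
open import Relation.Binary.PropositionalEquality using (_≡_; _≢_; refl; sym; trans; cong; subst; ≢-sym; module ≡-Reasoning)
open import Relation.Nullary using (¬_; Dec; yes; no)
open import Relation.Nullary.Decidable using (⌊_⌋; _×-dec_; _→-dec_; ¬?; decidable-stable)
open import Function.Definitions using (Injective)

Avoids : ∀ {n} → Fin n → Fin n → Fin n → Set
Avoids a b w = w ≢ a × w ≢ b

∉⇒Avoids : ∀ {n} {S : Subset n} {a b w} → a ∈ S → b ∈ S → w ∉ S → Avoids a b w
∉⇒Avoids a∈S b∈S w∉S = (λ { refl → w∉S a∈S }) , (λ { refl → w∉S b∈S })

module WalkProperties {n : ℕ} (G : Graph n) where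

  Adj-sym : ∀ {u v} → Adj G u v → Adj G v u
  Adj-sym {u} {v} e = trans (adj-sym G v u) e

  Adj⇒≢ : ∀ {u v} → Adj G u v → u ≢ v
  Adj⇒≢ {u} e refl with trans (sym e) (adj-irrefl G u)
  ... | ()

  Adj? : ∀ u v → Dec (Adj G u v)
  Adj? u v = adj G u v Bool.≟ true

  infixr 5 _++ʷ_

  _++ʷ_ : ∀ {u v w} → Walk G u v → Walk G v w → Walk G u w
  [ _ ]   ++ʷ q = q
  (e ∷ p) ++ʷ q = e ∷ (p ++ʷ q)

  reverse : ∀ {u v} → Walk G u v → Walk G v u
  reverse [ v ]         = [ v ]
  reverse (_∷_ {u} e p) = reverse p ++ʷ (Adj-sym e ∷ [ u ])

  len-++ : ∀ {u v w} (p : Walk G u v) (q : Walk G v w) → len G (p ++ʷ q) ≡ len G p + len G q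
  len-++ [ _ ]   q = refl
  len-++ (e ∷ p) q = cong suc (len-++ p q)

  len-reverse : ∀ {u v} (p : Walk G u v) → len G (reverse p) ≡ len G p
  len-reverse [ v ]         = refl
  len-reverse (_∷_ {u} e p) = trans (len-++ (reverse p) (Adj-sym e ∷ [ u ]))
                                    (trans (cong (_+ 1) (len-reverse p)) (+-comm (len G p) 1))

  Allʷ : (Fin n → Set) → ∀ {u v} → Walk G u v → Set
  Allʷ P [ v ]         = P v
  Allʷ P (_∷_ {u} e p) = P u × Allʷ P p

  module _ {P : Fin n → Set} where

    Allʷ-head : ∀ {u v} (p : Walk G u v) → Allʷ P p → P u
    Allʷ-head [ v ]   pv       = pv
    Allʷ-head (e ∷ p) (pu , _) = pu

    Allʷ-last : ∀ {u v} (p : Walk G u v) → Allʷ P p → P v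
    Allʷ-last [ v ]   pv       = pv
    Allʷ-last (e ∷ p) (_ , ps) = Allʷ-last p ps

    Allʷ-++ : ∀ {u v w} (p : Walk G u v) (q : Walk G v w) → Allʷ P p → Allʷ P q → Allʷ P (p ++ʷ q)
    Allʷ-++ [ _ ]   q _         qs = qs
    Allʷ-++ (e ∷ p) q (pu , ps) qs = pu , Allʷ-++ p q ps qs

    Allʷ-reverse : ∀ {u v} (p : Walk G u v) → Allʷ P p → Allʷ P (reverse p)
    Allʷ-reverse [ v ]   pv        = pv
    Allʷ-reverse (e ∷ p) (pu , ps) = Allʷ-++ (reverse p) _ (Allʷ-reverse p ps) (Allʷ-head p ps , pu)

    Allʷ-lookup : ∀ {w u v} (p : Walk G u v) → Allʷ P p → OnWalk G w p → P w
    Allʷ-lookup [ _ ]   pw       here-[]      = pw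
    Allʷ-lookup (e ∷ p) (pw , _) (here-∷ _ _) = pw
    Allʷ-lookup (e ∷ p) (_ , ps) (there _ o)  = Allʷ-lookup p ps o

  Allʷ-map : ∀ {P Q : Fin n → Set} → (∀ {x} → P x → Q x) → ∀ {u v} (p : Walk G u v) → Allʷ P p → Allʷ Q p
  Allʷ-map f [ v ]   pv        = f pv
  Allʷ-map f (e ∷ p) (pu , ps) = f pu , Allʷ-map f p ps

  onWalk? : ∀ w {u v} (p : Walk G u v) → Dec (OnWalk G w p)
  onWalk? w [ v ] with w ≟ v
  ... | yes refl = yes here-[]
  ... | no w≢v   = no λ { here-[] → w≢v refl }
  onWalk? w (_∷_ {u} e p) with w ≟ u | onWalk? w p
  ... | yes refl | _     = yes (here-∷ e p)
  ... | no _     | yes o = yes (there e o)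
  ... | no w≢u   | no ¬o = no λ { (here-∷ _ _) → w≢u refl ; (there _ o) → ¬o o }

  Simple : ∀ {u v} → Walk G u v → Set
  Simple [ v ]         = Unit
  Simple (_∷_ {u} e p) = ¬ OnWalk G u p × Simple p

  suffix : ∀ {w u v} (p : Walk G u v) → OnWalk G w p → Walk G w v
  suffix [ _ ]   here-[]      = [ _ ]
  suffix (e ∷ p) (here-∷ _ _) = e ∷ p
  suffix (e ∷ p) (there _ o)  = suffix p o

  Allʷ-suffix : ∀ {P : Fin n → Set} {w u v} (p : Walk G u v) (o : OnWalk G w p) → Allʷ P p → Allʷ P (suffix p o)
  Allʷ-suffix [ _ ]   here-[]      ps       = ps
  Allʷ-suffix (e ∷ p) (here-∷ _ _) ps       = ps
  Allʷ-suffix (e ∷ p) (there _ o)  (_ , ps) = Allʷ-suffix p o ps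

  Simple-suffix : ∀ {w u v} (p : Walk G u v) (o : OnWalk G w p) → Simple p → Simple (suffix p o)
  Simple-suffix [ _ ]   here-[]      s       = s
  Simple-suffix (e ∷ p) (here-∷ _ _) s       = s
  Simple-suffix (e ∷ p) (there _ o)  (_ , s) = Simple-suffix p o s

  simplify : ∀ (P : Fin n → Set) {u v} (p : Walk G u v) → Allʷ P p → Σ (Walk G u v) λ q → Allʷ P q × Simple q
  simplify P [ v ] pv = [ v ] , pv , tt
  simplify P (_∷_ {u} e p) (pu , ps) with simplify P p ps
  ... | q , qs , sq with onWalk? u q
  ...   | yes o = suffix q o , Allʷ-suffix q o qs , Simple-suffix q o sq
  ...   | no ¬o = e ∷ q , (pu , qs) , (¬o , sq)

  vertices : ∀ {u v} (p : Walk G u v) → Vec (Fin n) (suc (len G p))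
  vertices [ v ]         = v Vec.∷ Vec.[]
  vertices (_∷_ {u} e p) = u Vec.∷ vertices p

  lookup-vertices-first : ∀ {u v} (p : Walk G u v) → lookup (vertices p) zero ≡ u
  lookup-vertices-first [ v ]   = refl
  lookup-vertices-first (e ∷ p) = refl

  lookup-vertices-last : ∀ {u v} (p : Walk G u v) → lookup (vertices p) (fromℕ (len G p)) ≡ v
  lookup-vertices-last [ v ]   = refl
  lookup-vertices-last (e ∷ p) = lookup-vertices-last p

  lookup-vertices-OnWalk : ∀ {u v} (p : Walk G u v) (i : Fin (suc (len G p))) → OnWalk G (lookup (vertices p) i) p
  lookup-vertices-OnWalk [ v ]   zero    = here-[]
  lookup-vertices-OnWalk (e ∷ p) zero    = here-∷ e p
  lookup-vertices-OnWalk (e ∷ p) (suc i) = there e (lookup-vertices-OnWalk p i)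

  lookup-vertices-Adj : ∀ {u v} (p : Walk G u v) (i : Fin (len G p)) →
                        Adj G (lookup (vertices p) (inject₁ i)) (lookup (vertices p) (suc i))
  lookup-vertices-Adj (_∷_ {u} e p) zero    = subst (Adj G u) (sym (lookup-vertices-first p)) e
  lookup-vertices-Adj (e ∷ p)       (suc i) = lookup-vertices-Adj p i

  lookup-vertices-injective : ∀ {u v} (p : Walk G u v) → Simple p → Injective _≡_ _≡_ (lookup (vertices p))
  lookup-vertices-injective [ v ]   _        {zero}  {zero}  _  = refl
  lookup-vertices-injective (e ∷ p) _        {zero}  {zero}  _  = refl
  lookup-vertices-injective (e ∷ p) (¬o , _) {zero}  {suc j} eq =
    ⊥-elim (¬o (subst (λ x → OnWalk G x p) (sym eq) (lookup-vertices-OnWalk p j)))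
  lookup-vertices-injective (e ∷ p) (¬o , _) {suc i} {zero}  eq =
    ⊥-elim (¬o (subst (λ x → OnWalk G x p) eq (lookup-vertices-OnWalk p i)))
  lookup-vertices-injective (e ∷ p) (_ , s)  {suc i} {suc j} eq = cong suc (lookup-vertices-injective p s eq)

  -- The cycle is a, b, z, …, x once the walk from z to x has been made simple.
  bypass⇒HasCycle : ∀ {a b x z} → Adj G a b → Adj G x a → Adj G z b →
                    (r : Walk G z x) → Allʷ (Avoids a b) r → HasCycle G
  bypass⇒HasCycle {a} {b} a~b x~a z~b r avoids with simplify (Avoids a b) r avoids
  ... | q , avoidsq , simple = len G q , cycle , injective , consecutive , closing
    where
    cycle : Fin (suc (suc (suc (len G q)))) → Fin n
    cycle = lookup (a Vec.∷ b Vec.∷ vertices q)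

    avoids-at : ∀ {w} j → lookup (vertices q) j ≡ w → Avoids a b w
    avoids-at j eq = subst (Avoids a b) eq (Allʷ-lookup q avoidsq (lookup-vertices-OnWalk q j))

    injective : Injective _≡_ _≡_ cycle
    injective {zero}        {zero}        _  = refl
    injective {zero}        {suc zero}    eq = ⊥-elim (Adj⇒≢ a~b eq)
    injective {zero}        {suc (suc j)} eq = ⊥-elim (proj₁ (avoids-at j (sym eq)) refl)
    injective {suc zero}    {zero}        eq = ⊥-elim (Adj⇒≢ a~b (sym eq))
    injective {suc zero}    {suc zero}    _  = refl
    injective {suc zero}    {suc (suc j)} eq = ⊥-elim (proj₂ (avoids-at j (sym eq)) refl)
    injective {suc (suc i)} {zero}        eq = ⊥-elim (proj₁ (avoids-at i eq) refl)
    injective {suc (suc i)} {suc zero}    eq = ⊥-elim (proj₂ (avoids-at i eq) refl)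
    injective {suc (suc i)} {suc (suc j)} eq = cong (λ k → suc (suc k)) (lookup-vertices-injective q simple eq)

    consecutive : ∀ (i : Fin (suc (suc (len G q)))) → Adj G (cycle (inject₁ i)) (cycle (suc i))
    consecutive zero          = a~b
    consecutive (suc zero)    = subst (Adj G b) (sym (lookup-vertices-first q)) (Adj-sym z~b)
    consecutive (suc (suc i)) = lookup-vertices-Adj q i

    closing : Adj G (cycle (fromℕ (suc (suc (len G q))))) (cycle zero)
    closing = subst (λ w → Adj G w a) (sym (lookup-vertices-last q)) x~a

  ≢⇒1≤len : ∀ {s t} → s ≢ t → (q : Walk G s t) → 1 ≤ len G q
  ≢⇒1≤len s≢t [ _ ]   = ⊥-elim (s≢t refl)
  ≢⇒1≤len s≢t (e ∷ q) = s≤s z≤n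

  ¬Adj⇒2≤len : ∀ {s t} → s ≢ t → ¬ Adj G s t → (q : Walk G s t) → 2 ≤ len G q
  ¬Adj⇒2≤len s≢t _   [ _ ]              = ⊥-elim (s≢t refl)
  ¬Adj⇒2≤len _   s≁t (e ∷ [ _ ])        = ⊥-elim (s≁t e)
  ¬Adj⇒2≤len _   _   (e ∷ (e′ ∷ q))     = s≤s (s≤s z≤n)

  ¬CommonNeighbour⇒3≤len : ∀ {s t} → s ≢ t → ¬ Adj G s t → (∀ m → Adj G s m → Adj G m t → ⊥) →
                           (q : Walk G s t) → 3 ≤ len G q
  ¬CommonNeighbour⇒3≤len s≢t _   _ [ _ ]                   = ⊥-elim (s≢t refl)
  ¬CommonNeighbour⇒3≤len _   s≁t _ (e ∷ [ _ ])             = ⊥-elim (s≁t e)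
  ¬CommonNeighbour⇒3≤len _   _   c (e ∷ (e′ ∷ [ _ ]))      = ⊥-elim (c _ e e′)
  ¬CommonNeighbour⇒3≤len _   _   _ (e ∷ (e′ ∷ (e″ ∷ q)))   = s≤s (s≤s (s≤s z≤n))

  walk≤3⇒dist≤3 : ∀ {s t} (r : Walk G s t) → len G r ≤ 3 → ∃[ d ] (Dist G s t d × d ≤ 3)
  walk≤3⇒dist≤3 {s} {t} r r≤3 with s ≟ t | Adj? s t | any? (λ m → Adj? s m ×-dec Adj? m t)
  ... | yes refl | _       | _                  = 0 , ([ s ] , (λ _ → z≤n) , refl) , z≤n
  ... | no s≢t   | yes s~t | _                  = 1 , ((s~t ∷ [ t ]) , ≢⇒1≤len s≢t , refl) , s≤s z≤n
  ... | no s≢t   | no s≁t  | yes (m , s~m , m~t) =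
        2 , ((s~m ∷ (m~t ∷ [ t ])) , ¬Adj⇒2≤len s≢t s≁t , refl) , s≤s (s≤s z≤n)
  ... | no s≢t   | no s≁t  | no ¬common        =
        len G r , (r , (λ q → ≤-trans r≤3 (¬CommonNeighbour⇒3≤len s≢t s≁t (λ m e e′ → ¬common (m , e , e′)) q)) , refl) , r≤3

  data FirstHit (a b : Fin n) {w t : Fin n} (r : Walk G w t) : Set where
    misses : Allʷ (Avoids a b) r → FirstHit a b r
    hits   : ∀ {x c} → c ≡ a ⊎ c ≡ b → (pre : Walk G w x) → Allʷ (Avoids a b) pre → Adj G x c →
             (rest : Walk G c t) → len G r ≡ len G pre + suc (len G rest) → FirstHit a b r

  firstHit : ∀ a b {w t} (r : Walk G w t) → Avoids a b w → FirstHit a b r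
  firstHit a b [ w ] avoids = misses avoids
  firstHit a b (_∷_ {w} {s} e r) avoids with s ≟ a | s ≟ b
  ... | yes s≡a | _       = hits (inj₁ s≡a) [ w ] avoids e r refl
  ... | no _    | yes s≡b = hits (inj₂ s≡b) [ w ] avoids e r refl
  ... | no s≢a  | no s≢b with firstHit a b r (s≢a , s≢b)
  ...   | misses avoidsr                    = misses (avoids , avoidsr)
  ...   | hits c pre avoidspre x~c rest eq = hits c (e ∷ pre) (avoids , avoidspre) x~c rest (cong suc eq)

∣p∪q∣≤∣p∣+∣q∣ : ∀ {m} (p q : Subset m) → ∣ p ∪ q ∣ ≤ ∣ p ∣ + ∣ q ∣
∣p∪q∣≤∣p∣+∣q∣ Vec.[]            Vec.[]            = z≤n
∣p∪q∣≤∣p∣+∣q∣ (inside Vec.∷ p)  (inside Vec.∷ q)  = s≤s (≤-trans (∣p∪q∣≤∣p∣+∣q∣ p q) (+-monoʳ-≤ ∣ p ∣ (n≤1+n ∣ q ∣)))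
∣p∪q∣≤∣p∣+∣q∣ (inside Vec.∷ p)  (outside Vec.∷ q) = s≤s (∣p∪q∣≤∣p∣+∣q∣ p q)
∣p∪q∣≤∣p∣+∣q∣ (outside Vec.∷ p) (inside Vec.∷ q)  = subst (suc ∣ p ∪ q ∣ ≤_) (sym (+-suc ∣ p ∣ ∣ q ∣)) (s≤s (∣p∪q∣≤∣p∣+∣q∣ p q))
∣p∪q∣≤∣p∣+∣q∣ (outside Vec.∷ p) (outside Vec.∷ q) = ∣p∪q∣≤∣p∣+∣q∣ p q

fromList : ∀ {m} → List (Fin m) → Subset m
fromList = foldr (λ x p → ⁅ x ⁆ ∪ p) ∅

∣fromList∣≤length : ∀ {m} (xs : List (Fin m)) → ∣ fromList xs ∣ ≤ length xs
∣fromList∣≤length {m} []       = ≤-reflexive (∣⊥∣≡0 m)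
∣fromList∣≤length      (x ∷ xs) = ≤-trans (∣p∪q∣≤∣p∣+∣q∣ ⁅ x ⁆ (fromList xs))
                                          (+-mono-≤ (≤-reflexive (∣⁅x⁆∣≡1 x)) (∣fromList∣≤length xs))

∈-fromList⁺ : ∀ {m} {x : Fin m} xs → x ∈ˡ xs → x ∈ fromList xs
∈-fromList⁺ (x ∷ _)  (here refl)  = x∈p∪q⁺ (inj₁ (x∈⁅x⁆ x))
∈-fromList⁺ (_ ∷ xs) (there x∈xs) = x∈p∪q⁺ (inj₂ (∈-fromList⁺ xs x∈xs))

Unique∧All∈⇒length≤∣p∣ : ∀ {m} {p : Subset m} {xs} → Unique xs → All (_∈ p) xs → length xs ≤ ∣ p ∣
Unique∧All∈⇒length≤∣p∣ []             []             = z≤n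
Unique∧All∈⇒length≤∣p∣ (x≢xs ∷ unique) (x∈p ∷ xs⊆p) =
  ≤-trans (s≤s (Unique∧All∈⇒length≤∣p∣ unique (All.zipWith (λ (y∈p , x≢y) → x∈p∧x≢y⇒x∈p-y y∈p (≢-sym x≢y))
                                                             (xs⊆p , x≢xs))))
          (x∈p⇒∣p-x∣<∣p∣ x∈p)

-- Search the sizes 0, 1, 2, … in turn; the search ends at the latest at ∣ S₀ ∣.
minimal-subset : ∀ {m} (Q : Subset m → Set) → (∀ S → Dec (Q S)) → (S₀ : Subset m) → Q S₀ →
                 ∃[ S ] (Q S × (∀ S′ → Q S′ → ∣ S ∣ ≤ ∣ S′ ∣))
minimal-subset {m} Q Q? S₀ QS₀ = search 0 ∣ S₀ ∣ (+-identityʳ ∣ S₀ ∣) (λ _ _ → z≤n)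
  where
  search : ∀ k fuel → fuel + k ≡ ∣ S₀ ∣ → (∀ S → Q S → k ≤ ∣ S ∣) →
           ∃[ S ] (Q S × (∀ S′ → Q S′ → ∣ S ∣ ≤ ∣ S′ ∣))
  search k fuel eq lower with anySubset? (λ S → Q? S ×-dec (∣ S ∣ ℕ.≟ k))
  ... | yes (S , QS , ∣S∣≡k) = S , QS , λ S′ QS′ → subst (_≤ ∣ S′ ∣) (sym ∣S∣≡k) (lower S′ QS′)
  search k zero       eq lower | no none = ⊥-elim (none (S₀ , QS₀ , sym eq))
  search k (suc fuel) eq lower | no none =
    search (suc k) fuel (trans (+-suc fuel k) eq) (λ S QS → ≤∧≢⇒< (lower S QS) (λ k≡∣S∣ → none (S , QS , sym k≡∣S∣)))

module Neighbourhoods {n : ℕ} (G : Graph n) where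
  open WalkProperties G using (Adj?)

  neighbours : Fin n → Subset n
  neighbours v = tabulate (adj G v)

  ∈-neighbours⁺ : ∀ {v u} → Adj G v u → u ∈ neighbours v
  ∈-neighbours⁺ {v} {u} e = lookup⇒[]= u (neighbours v) (trans (lookup∘tabulate (adj G v) u) e)

  ∈-neighbours⁻ : ∀ {v u} → u ∈ neighbours v → Adj G v u
  ∈-neighbours⁻ {v} {u} u∈ = trans (sym (lookup∘tabulate (adj G v) u)) ([]=⇒lookup u∈)

  degree≡2⇒neighbour∈ : ∀ {v x y u} → degree G v ≡ 2 → Adj G v x → Adj G v y → x ≢ y → Adj G v u → u ≡ x ⊎ u ≡ y
  degree≡2⇒neighbour∈ {x = x} {y} {u} deg≡2 v~x v~y x≢y v~u with u ≟ x | u ≟ y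
  ... | yes u≡x | _       = inj₁ u≡x
  ... | no _    | yes u≡y = inj₂ u≡y
  ... | no u≢x  | no u≢y  = ⊥-elim (<⇒≱ (ℕ.n<1+n 2) (subst (3 ≤_) deg≡2
          (Unique∧All∈⇒length≤∣p∣ ((x≢y ∷ ≢-sym u≢x ∷ []) ∷ (≢-sym u≢y ∷ []) ∷ [] ∷ [])
                                   (∈-neighbours⁺ v~x ∷ ∈-neighbours⁺ v~y ∷ ∈-neighbours⁺ v~u ∷ []))))

  ¬degree≡2⇒third-neighbour : ∀ {v x y} → degree G v ≢ 2 → Adj G v x → Adj G v y → x ≢ y →
                              ∃[ u ] (Adj G v u × u ≢ x × u ≢ y)
  ¬degree≡2⇒third-neighbour {v} {x} {y} deg≢2 v~x v~y x≢y with any? (λ u → Adj? v u ×-dec (¬? (u ≟ x) ×-dec ¬? (u ≟ y)))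
  ... | yes third = third
  ... | no none   = ⊥-elim (deg≢2 (≤-antisym at-most-2 at-least-2))
    where
    neighbours⊆xy : neighbours v ⊆ fromList (x ∷ y ∷ [])
    neighbours⊆xy {u} u∈ with u ≟ x | u ≟ y
    ... | yes refl | _        = ∈-fromList⁺ (x ∷ y ∷ []) (here refl)
    ... | no _     | yes refl = ∈-fromList⁺ (x ∷ y ∷ []) (there (here refl))
    ... | no u≢x   | no u≢y   = ⊥-elim (none (u , ∈-neighbours⁻ u∈ , u≢x , u≢y))

    at-most-2 : degree G v ≤ 2
    at-most-2 = ≤-trans (p⊆q⇒∣p∣≤∣q∣ neighbours⊆xy) (∣fromList∣≤length (x ∷ y ∷ []))

    at-least-2 : 2 ≤ degree G v
    at-least-2 = Unique∧All∈⇒length≤∣p∣ ((x≢y ∷ []) ∷ [] ∷ []) (∈-neighbours⁺ v~x ∷ ∈-neighbours⁺ v~y ∷ [])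

module Flanking {n : ℕ} (G : Graph n) where
  open WalkProperties G

  FlankPair : Subset n → Fin n → Set
  FlankPair S w = ∃[ u ] ∃[ v ] (u ∈ S × v ∈ S × Adj G w u × Adj G w v × u ≢ v × ¬ Adj G u v)

  Flanked : Subset n → Fin n → Set
  Flanked S w = w ∈ S ⊎ FlankPair S w

  Flanks : Subset n → Set
  Flanks S = ∀ w → w ∉ S → FlankPair S w

  flanks? : ∀ S → Dec (Flanks S)
  flanks? S = all? λ w → ¬? (w ∈? S) →-dec
    any? (λ u → any? (λ v → (u ∈? S) ×-dec (v ∈? S) ×-dec Adj? w u ×-dec Adj? w v ×-dec ¬? (u ≟ v) ×-dec ¬? (Adj? u v)))

  Flanked⇒Interval : ∀ {S w} → Flanked S w → Interval G S w
  Flanked⇒Interval {w = w} (inj₁ w∈S) = w , w , w∈S , w∈S , [ w ] , (λ _ → z≤n) , here-[]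
  Flanked⇒Interval (inj₂ (u , v , u∈S , v∈S , w~u , w~v , u≢v , u≁v)) =
    u , v , u∈S , v∈S , (Adj-sym w~u ∷ (w~v ∷ [ v ])) , ¬Adj⇒2≤len u≢v u≁v , there _ (here-∷ w~v [ v ])

  Flanks⇒TwoGeodetic : ∀ {S} → Flanks S → TwoGeodetic G S
  Flanks⇒TwoGeodetic {S} flanks = (λ w → Flanked⇒Interval (flanked w)) , flanks
    where
    flanked : ∀ w → Flanked S w
    flanked w with w ∈? S
    ... | yes w∈S = inj₁ w∈S
    ... | no w∉S  = inj₂ (flanks w w∉S)

  g₂≡length : ∀ xs → Flanks (fromList xs) → (∀ {S} → Flanks S → length xs ≤ ∣ S ∣) → TwoGeodeticNumber G (length xs)
  g₂≡length xs flanks lower = (fromList xs , Flanks⇒TwoGeodetic flanks , ≤-antisym (∣fromList∣≤length xs) (lower flanks))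
                            , (λ _ twoGeodetic → lower (proj₂ twoGeodetic))

  ShortGeodesics : Set
  ShortGeodesics = ∀ {u v} (p : Walk G u v) → Geodesic G p → len G p ≤ 2

  Interval⇒Flanked : ShortGeodesics → ∀ {S w} → Interval G S w → Flanked S w
  Interval⇒Flanked short {S} {w} (u , v , u∈S , v∈S , p , geodesic , onp) = go p geodesic onp u∈S v∈S
    where
    go : ∀ {u v} (p : Walk G u v) → Geodesic G p → OnWalk G w p → u ∈ S → v ∈ S → Flanked S w
    go [ _ ]              _ here-[]                     u∈S _   = inj₁ u∈S
    go (e ∷ [ _ ])        _ (here-∷ _ _)                u∈S _   = inj₁ u∈S
    go (e ∷ [ _ ])        _ (there _ here-[])           _   v∈S = inj₁ v∈S
    go (e ∷ (e′ ∷ [ _ ])) _ (here-∷ _ _)                u∈S _   = inj₁ u∈S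
    go (e ∷ (e′ ∷ [ _ ])) _ (there _ (there _ here-[])) _   v∈S = inj₁ v∈S
    go {u} {v} (e ∷ (e′ ∷ [ _ ])) geodesic (there _ (here-∷ _ _)) u∈S v∈S =
      inj₂ (u , v , u∈S , v∈S , Adj-sym e , e′ , u≢v , u≁v)
      where
      u≢v : u ≢ v
      u≢v refl with geodesic [ u ]
      ... | ()
      u≁v : ¬ Adj G u v
      u≁v u~v with geodesic (u~v ∷ [ v ])
      ... | s≤s ()
    go p@(e ∷ (e′ ∷ (e″ ∷ _))) geodesic _ _ _ with short p geodesic
    ... | s≤s (s≤s ())

  Geodetic⇒Flanks : ShortGeodesics → ∀ {S} → Geodetic G S → Flanks S
  Geodetic⇒Flanks short geodetic w w∉S with Interval⇒Flanked short (geodetic w)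
  ... | inj₁ w∈S = ⊥-elim (w∉S w∈S)
  ... | inj₂ pair = pair

  short-geodesics⇒g≡g₂ : ShortGeodesics → ∃[ k ] (GeodeticNumber G k × TwoGeodeticNumber G k)
  short-geodesics⇒g≡g₂ short with minimal-subset Flanks flanks? full (λ w w∉full → ⊥-elim (w∉full ∈⊤))
  ... | S , flanks , minimal =
      ∣ S ∣
    , ((S , proj₁ (Flanks⇒TwoGeodetic flanks) , refl) , (λ S′ geodetic → minimal S′ (Geodetic⇒Flanks short geodetic)))
    , ((S , Flanks⇒TwoGeodetic flanks , refl) , (λ S′ twoGeodetic → minimal S′ (proj₂ twoGeodetic)))

module Trees {n : ℕ} (T : Graph n) where
  open WalkProperties T
  open Neighbourhoods T

  infix 4 _~_ _~ᶜ_

  _~_ : Fin n → Fin n → Set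
  u ~ v = Adj T u v

  Ĉ : Graph n
  Ĉ = complement T

  _~ᶜ_ : Fin n → Fin n → Set
  u ~ᶜ v = Adj Ĉ u v

  ~ᶜ-intro : ∀ {u v} → ¬ u ~ v → u ≢ v → u ~ᶜ v
  ~ᶜ-intro {u} {v} u≁v u≢v with adj T u v | u ≟ v
  ... | true  | _       = ⊥-elim (u≁v refl)
  ... | false | yes u≡v = ⊥-elim (u≢v u≡v)
  ... | false | no _    = refl

  ~ᶜ⇒≁ : ∀ {u v} → u ~ᶜ v → ¬ u ~ v
  ~ᶜ⇒≁ {u} {v} u~ᶜv u~v with subst (λ b → (not b ∧ not ⌊ u ≟ v ⌋) ≡ true) u~v u~ᶜv
  ... | ()

  ~ᶜ⇒≢ : ∀ {u v} → u ~ᶜ v → u ≢ v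
  ~ᶜ⇒≢ = WalkProperties.Adj⇒≢ Ĉ

  ≁ᶜ⇒~ : ∀ {u v} → ¬ u ~ᶜ v → u ≢ v → u ~ v
  ≁ᶜ⇒~ {u} {v} u≁ᶜv u≢v with Adj? u v
  ... | yes u~v = u~v
  ... | no u≁v  = ⊥-elim (u≁ᶜv (~ᶜ-intro u≁v u≢v))

  -- Centres a, b with a leaf p at a and a leaf q at b; once T is acyclic every vertex other than a, b is a leaf.
  record DoubleStar (a b p q : Fin n) : Set where
    field
      a~b        : a ~ b
      p~a        : p ~ a
      q~b        : q ~ b
      p≢b        : p ≢ b
      q≢a        : q ≢ a
      dominating : ∀ w → w ≡ a ⊎ w ≡ b ⊎ w ~ a ⊎ w ~ b

  swap : ∀ {a b p q} → DoubleStar a b p q → DoubleStar b a q p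
  swap {a} {b} d = record { a~b = Adj-sym a~b ; p~a = q~b ; q~b = p~a ; p≢b = q≢a ; q≢a = p≢b ; dominating = dominating′ }
    where
    open DoubleStar d
    dominating′ : ∀ w → w ≡ b ⊎ w ≡ a ⊎ w ~ b ⊎ w ~ a
    dominating′ w with dominating w
    ... | inj₁ w≡a                = inj₂ (inj₁ w≡a)
    ... | inj₂ (inj₁ w≡b)         = inj₁ w≡b
    ... | inj₂ (inj₂ (inj₁ w~a))  = inj₂ (inj₂ (inj₂ w~a))
    ... | inj₂ (inj₂ (inj₂ w~b))  = inj₂ (inj₂ (inj₁ w~b))

  -- In a geodesic u x y z … of Ĉ, the pair u z has no common Ĉ-neighbour, so every vertex is T-adjacent to u or z.
  long-complement-geodesic⇒DoubleStar : ∀ {u x y z v} (u~x : u ~ᶜ x) (x~y : x ~ᶜ y) (y~z : y ~ᶜ z) (rest : Walk Ĉ z v) →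
                                       Geodesic Ĉ (u~x ∷ (x~y ∷ (y~z ∷ rest))) → DoubleStar u z y x
  long-complement-geodesic⇒DoubleStar {u} {x} {y} {z} u~x x~y y~z rest geodesic = record
    { a~b = ≁ᶜ⇒~ u≁ᶜz u≢z
    ; p~a = Adj-sym (≁ᶜ⇒~ (λ u~y → ¬common y u~y y~z) u≢y)
    ; q~b = ≁ᶜ⇒~ (λ x~z → ¬common x u~x x~z) x≢z
    ; p≢b = ~ᶜ⇒≢ y~z
    ; q≢a = λ x≡u → ~ᶜ⇒≢ u~x (sym x≡u)
    ; dominating = dominating }
    where
    L : ℕ
    L = len Ĉ rest
    u≢z : u ≢ z
    u≢z refl = <⇒≱ (m<n+m L (s≤s z≤n)) (geodesic rest)
    u≁ᶜz : ¬ u ~ᶜ z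
    u≁ᶜz u~z = <⇒≱ (m<n+m (suc L) {2} (s≤s z≤n)) (geodesic (u~z ∷ rest))
    ¬common : ∀ m → u ~ᶜ m → m ~ᶜ z → ⊥
    ¬common m u~m m~z = <⇒≱ (m<n+m (suc (suc L)) {1} (s≤s z≤n)) (geodesic (u~m ∷ (m~z ∷ rest)))
    u≢y : u ≢ y
    u≢y refl = u≁ᶜz y~z
    x≢z : x ≢ z
    x≢z refl = u≁ᶜz u~x
    dominating : ∀ w → w ≡ u ⊎ w ≡ z ⊎ w ~ u ⊎ w ~ z
    dominating w with w ≟ u | w ≟ z | Adj? w u | Adj? w z
    ... | yes w≡u | _       | _       | _       = inj₁ w≡u
    ... | no _    | yes w≡z | _       | _       = inj₂ (inj₁ w≡z)
    ... | no _    | no _    | yes w~u | _       = inj₂ (inj₂ (inj₁ w~u))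
    ... | no _    | no _    | no _    | yes w~z = inj₂ (inj₂ (inj₂ w~z))
    ... | no w≢u  | no w≢z  | no w≁u  | no w≁z  =
          ⊥-elim (¬common w (~ᶜ-intro (λ u~w → w≁u (Adj-sym u~w)) (≢-sym w≢u)) (~ᶜ-intro w≁z w≢z))

  module Acyclic (acyclic : ¬ HasCycle T) where

    no-triangle : ∀ {x y z} → x ~ y → z ~ x → z ~ y → ⊥
    no-triangle x~y z~x z~y = acyclic (bypass⇒HasCycle x~y z~x z~y [ _ ] (Adj⇒≢ z~x , Adj⇒≢ z~y))

    no-square : ∀ {a b w w′} → a ~ b → w ~ a → w′ ~ b → w ~ w′ → Avoids a b w → Avoids a b w′ → ⊥
    no-square a~b w~a w′~b w~w′ avoids avoids′ =
      acyclic (bypass⇒HasCycle a~b w~a w′~b (Adj-sym w~w′ ∷ [ _ ]) (avoids′ , avoids))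

    module DoubleStarProperties {a b p q : Fin n} (d : DoubleStar a b p q) where
      open DoubleStar d

      ¬~both : ∀ {w} → w ~ a → w ~ b → ⊥
      ¬~both = no-triangle a~b

      leaf-side : ∀ {w} → Avoids a b w → w ~ a ⊎ w ~ b
      leaf-side {w} (w≢a , w≢b) with dominating w
      ... | inj₁ w≡a         = ⊥-elim (w≢a w≡a)
      ... | inj₂ (inj₁ w≡b)  = ⊥-elim (w≢b w≡b)
      ... | inj₂ (inj₂ side) = side

      leaves-nonadjacent : ∀ {w w′} → Avoids a b w → Avoids a b w′ → ¬ w ~ w′
      leaves-nonadjacent avoids avoids′ w~w′ with leaf-side avoids | leaf-side avoids′
      ... | inj₁ w~a | inj₁ w′~a = no-triangle w~w′ (Adj-sym w~a) (Adj-sym w′~a)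
      ... | inj₁ w~a | inj₂ w′~b = no-square a~b w~a w′~b w~w′ avoids avoids′
      ... | inj₂ w~b | inj₁ w′~a = no-square a~b w′~a w~b (Adj-sym w~w′) avoids′ avoids
      ... | inj₂ w~b | inj₂ w′~b = no-triangle w~w′ (Adj-sym w~b) (Adj-sym w′~b)

      leaf-neighbour : ∀ {v u} → Avoids a b v → v ~ u → u ≡ a ⊎ u ≡ b
      leaf-neighbour {u = u} avoids v~u with u ≟ a | u ≟ b
      ... | yes u≡a | _       = inj₁ u≡a
      ... | no _    | yes u≡b = inj₂ u≡b
      ... | no u≢a  | no u≢b  = ⊥-elim (leaves-nonadjacent avoids (u≢a , u≢b) v~u)

      leaf-degree≤1 : ∀ {v} → Avoids a b v → degree T v ≤ 1
      leaf-degree≤1 {v} avoids with leaf-side avoids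
      ... | inj₁ v~a = ≤-trans (p⊆q⇒∣p∣≤∣q∣ only-a) (≤-reflexive (∣⁅x⁆∣≡1 a))
        where
        only-a : neighbours v ⊆ ⁅ a ⁆
        only-a u∈ with leaf-neighbour avoids (∈-neighbours⁻ u∈)
        ... | inj₁ refl = x∈⁅x⁆ a
        ... | inj₂ refl = ⊥-elim (¬~both v~a (∈-neighbours⁻ u∈))
      ... | inj₂ v~b = ≤-trans (p⊆q⇒∣p∣≤∣q∣ only-b) (≤-reflexive (∣⁅x⁆∣≡1 b))
        where
        only-b : neighbours v ⊆ ⁅ b ⁆
        only-b u∈ with leaf-neighbour avoids (∈-neighbours⁻ u∈)
        ... | inj₁ refl = ⊥-elim (¬~both (∈-neighbours⁻ u∈) v~b)
        ... | inj₂ refl = x∈⁅x⁆ b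

      a≢b : a ≢ b
      a≢b = Adj⇒≢ a~b

      p-avoids : Avoids a b p
      p-avoids = Adj⇒≢ p~a , p≢b

      q-avoids : Avoids a b q
      q-avoids = q≢a , Adj⇒≢ q~b

      centres-and-leaf : ∀ {x} → Avoids a b x → Unique (a ∷ b ∷ x ∷ [])
      centres-and-leaf (x≢a , x≢b) = (a≢b ∷ ≢-sym x≢a ∷ []) ∷ (≢-sym x≢b ∷ []) ∷ [] ∷ []

      centres-and-leaves : ∀ {x y} → Avoids a b x → Avoids a b y → x ≢ y → Unique (a ∷ b ∷ x ∷ y ∷ [])
      centres-and-leaves (x≢a , x≢b) (y≢a , y≢b) x≢y =
        (a≢b ∷ ≢-sym x≢a ∷ ≢-sym y≢a ∷ []) ∷ (≢-sym x≢b ∷ ≢-sym y≢b ∷ []) ∷ (x≢y ∷ []) ∷ [] ∷ []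

      Centre : Fin n → Set
      Centre c = c ≡ a ⊎ c ≡ b

      to-centre : ∀ s → ∃[ c ] (Centre c × Σ (Walk T s c) λ r → len T r ≤ 1)
      to-centre s with dominating s
      ... | inj₁ refl               = a , inj₁ refl , [ a ] , z≤n
      ... | inj₂ (inj₁ refl)        = b , inj₂ refl , [ b ] , z≤n
      ... | inj₂ (inj₂ (inj₁ s~a)) = a , inj₁ refl , (s~a ∷ [ a ]) , s≤s z≤n
      ... | inj₂ (inj₂ (inj₂ s~b)) = b , inj₂ refl , (s~b ∷ [ b ]) , s≤s z≤n

      between-centres : ∀ {c c′} → Centre c → Centre c′ → Σ (Walk T c c′) λ r → len T r ≤ 1
      between-centres (inj₁ refl) (inj₁ refl) = [ a ] , z≤n
      between-centres (inj₁ refl) (inj₂ refl) = (a~b ∷ [ b ]) , s≤s z≤n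
      between-centres (inj₂ refl) (inj₁ refl) = (Adj-sym a~b ∷ [ a ]) , s≤s z≤n
      between-centres (inj₂ refl) (inj₂ refl) = [ b ] , z≤n

      walk≤3 : ∀ s t → Σ (Walk T s t) λ r → len T r ≤ 3
      walk≤3 s t with to-centre s | to-centre t
      ... | c , c-centre , r₁ , r₁≤1 | c′ , c′-centre , r₃ , r₃≤1 with between-centres c-centre c′-centre
      ...   | r₂ , r₂≤1 = r₁ ++ʷ r₂ ++ʷ reverse r₃ , length≤3
        where
        open ≡-Reasoning
        length≤3 : len T (r₁ ++ʷ r₂ ++ʷ reverse r₃) ≤ 3
        length≤3 = subst (_≤ 3) (sym (begin
            len T (r₁ ++ʷ r₂ ++ʷ reverse r₃)           ≡⟨ len-++ r₁ (r₂ ++ʷ reverse r₃) ⟩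
            len T r₁ + len T (r₂ ++ʷ reverse r₃)       ≡⟨ cong (len T r₁ +_) (len-++ r₂ (reverse r₃)) ⟩
            len T r₁ + (len T r₂ + len T (reverse r₃)) ≡⟨ cong (λ k → len T r₁ + (len T r₂ + k)) (len-reverse r₃) ⟩
            len T r₁ + (len T r₂ + len T r₃)           ∎))
          (+-mono-≤ r₁≤1 (+-mono-≤ r₂≤1 r₃≤1))

      diameter≡3 : Diameter T 3
      diameter≡3 = (λ s t → walk≤3⇒dist≤3 (proj₁ (walk≤3 s t)) (proj₂ (walk≤3 s t)))
                 , p , q , (p~a ∷ (a~b ∷ (Adj-sym q~b ∷ [ q ]))) , ¬CommonNeighbour⇒3≤len p≢q p≁q ¬common , refl
        where
        p≢q : p ≢ q
        p≢q refl = ¬~both p~a q~b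
        p≁q : ¬ p ~ q
        p≁q = leaves-nonadjacent p-avoids q-avoids
        ¬common : ∀ m → p ~ m → m ~ q → ⊥
        ¬common m p~m m~q with m ≟ a | m ≟ b
        ... | yes refl | _        = ¬~both (Adj-sym m~q) q~b
        ... | no _     | yes refl = ¬~both p~a p~m
        ... | no m≢a   | no m≢b   = leaves-nonadjacent p-avoids (m≢a , m≢b) p~m

    -- By acyclicity a walk from w to q meets a before b, and passing through a costs at least 1 + 1 + 2 steps.
    far-from-opposite-leaf : ∀ {a b q w x} → a ~ b → q ~ b → a ≢ q → ¬ a ~ q → ¬ w ~ a →
                             (pre : Walk T w x) → Allʷ (Avoids a b) pre → x ~ a → (r : Walk T w q) → 4 ≤ len T r
    far-from-opposite-leaf {a} {b} a~b q~b a≢q a≁q w≁a pre avoids x~a r with firstHit a b r (Allʷ-head pre avoids)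
    ... | misses avoidsr =
          ⊥-elim (acyclic (bypass⇒HasCycle a~b x~a q~b (reverse r ++ʷ pre) (Allʷ-++ (reverse r) pre (Allʷ-reverse r avoidsr) avoids)))
    ... | hits (inj₂ refl) pre′ avoids′ x′~b _ _ =
          ⊥-elim (acyclic (bypass⇒HasCycle a~b x~a x′~b (reverse pre′ ++ʷ pre) (Allʷ-++ (reverse pre′) pre (Allʷ-reverse pre′ avoids′) avoids)))
    ... | hits (inj₁ refl) pre′ _ x′~a rest eq =
          subst (4 ≤_) (sym eq) (+-mono-≤ (≢⇒1≤len (λ { refl → w≁a x′~a }) pre′) (s≤s (¬Adj⇒2≤len a≢q a≁q rest)))

    diameter≡3⇒DoubleStar : Diameter T 3 → ∃[ a ] ∃[ b ] ∃[ p ] ∃[ q ] DoubleStar a b p q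
    diameter≡3⇒DoubleStar (_ , _ , _ , [ _ ] , _ , ())
    diameter≡3⇒DoubleStar (_ , _ , _ , (_ ∷ [ _ ]) , _ , ())
    diameter≡3⇒DoubleStar (_ , _ , _ , (_ ∷ (_ ∷ [ _ ])) , _ , ())
    diameter≡3⇒DoubleStar (_ , _ , _ , (_ ∷ (_ ∷ (_ ∷ (_ ∷ _)))) , _ , ())
    diameter≡3⇒DoubleStar (bounded , p , q , (_∷_ {v = a} p~a (_∷_ {v = b} a~b (b~q ∷ [ _ ]))) , geodesic , refl) =
      a , b , p , q , record { a~b = a~b ; p~a = p~a ; q~b = Adj-sym b~q ; p≢b = p≢b ; q≢a = q≢a ; dominating = dominating }
      where
      p≢b : p ≢ b
      p≢b refl with geodesic (b~q ∷ [ q ])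
      ... | s≤s ()
      q≢a : q ≢ a
      q≢a refl with geodesic (p~a ∷ [ q ])
      ... | s≤s ()
      a≁q : ¬ a ~ q
      a≁q a~q with geodesic (p~a ∷ (a~q ∷ [ q ]))
      ... | s≤s (s≤s ())
      b≁p : ¬ b ~ p
      b≁p b~p with geodesic (Adj-sym b~p ∷ (b~q ∷ [ q ]))
      ... | s≤s (s≤s ())
      short-walk : ∀ w t → Σ (Walk T w t) λ r → len T r ≤ 3
      short-walk w t with bounded w t
      ... | _ , (r , _ , refl) , r≤3 = r , r≤3
      4≰short : ∀ {w t} → 4 ≤ len T (proj₁ (short-walk w t)) → ⊥
      4≰short {w} {t} 4≤ = <⇒≱ (ℕ.n<1+n 3) (≤-trans 4≤ (proj₂ (short-walk w t)))
      ¬isolated : ∀ {w} → Avoids a b w → ¬ w ~ a → ¬ w ~ b → ⊥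
      ¬isolated {w} avoids w≁a w≁b with firstHit a b (proj₁ (short-walk w a)) avoids
      ... | misses avoidsr = proj₁ (Allʷ-last (proj₁ (short-walk w a)) avoidsr) refl
      ... | hits (inj₁ refl) pre avoidspre x~a _ _ =
            4≰short (far-from-opposite-leaf a~b (Adj-sym b~q) (λ a≡q → q≢a (sym a≡q)) a≁q w≁a pre avoidspre x~a
                                            (proj₁ (short-walk w q)))
      ... | hits (inj₂ refl) pre avoidspre x~b _ _ =
            4≰short (far-from-opposite-leaf (Adj-sym a~b) p~a (λ b≡p → p≢b (sym b≡p)) b≁p w≁b pre
                                            (Allʷ-map Product.swap pre avoidspre) x~b (proj₁ (short-walk w p)))
      dominating : ∀ w → w ≡ a ⊎ w ≡ b ⊎ w ~ a ⊎ w ~ b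
      dominating w with w ≟ a | w ≟ b | Adj? w a | Adj? w b
      ... | yes w≡a | _       | _       | _       = inj₁ w≡a
      ... | no _    | yes w≡b | _       | _       = inj₂ (inj₁ w≡b)
      ... | no _    | no _    | yes w~a | _       = inj₂ (inj₂ (inj₁ w~a))
      ... | no _    | no _    | no _    | yes w~b = inj₂ (inj₂ (inj₂ w~b))
      ... | no w≢a  | no w≢b  | no w≁a  | no w≁b  = ⊥-elim (¬isolated (w≢a , w≢b) w≁a w≁b)

    ¬diameter≡3⇒ShortGeodesics : ¬ Diameter T 3 → Flanking.ShortGeodesics Ĉ
    ¬diameter≡3⇒ShortGeodesics _ [ _ ]                         _        = z≤n
    ¬diameter≡3⇒ShortGeodesics _ (_ ∷ [ _ ])                   _        = s≤s z≤n
    ¬diameter≡3⇒ShortGeodesics _ (_ ∷ (_ ∷ [ _ ]))             _        = s≤s (s≤s z≤n)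
    ¬diameter≡3⇒ShortGeodesics ¬d (e₁ ∷ (e₂ ∷ (e₃ ∷ rest))) geodesic =
      ⊥-elim (¬d (DoubleStarProperties.diameter≡3 (long-complement-geodesic⇒DoubleStar e₁ e₂ e₃ rest geodesic)))

    open Flanking Ĉ using (FlankPair; Flanks; g₂≡length)

    centre∈ : ∀ {a b p q S} → DoubleStar a b p q → Flanks S → a ∈ S
    centre∈ {a} {b} {S = S} d flanks = decidable-stable (a ∈? S) λ a∉S →
      let α , β , _ , _ , a~α , a~β , α≢β , α≁β = flanks a a∉S
      in leaves-nonadjacent (neighbour-avoids a~α) (neighbour-avoids a~β) (≁ᶜ⇒~ α≁β α≢β)
      where
      open DoubleStar d
      open DoubleStarProperties d
      neighbour-avoids : ∀ {x} → a ~ᶜ x → Avoids a b x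
      neighbour-avoids a~x = (λ x≡a → ~ᶜ⇒≢ a~x (sym x≡a)) , (λ { refl → ~ᶜ⇒≁ a~x a~b })

    -- The Ĉ-neighbours of a leaf r at b are a and the other leaves; a flank pair must be T-adjacent, so one of them is a.
    leaf∉⇒opposite-leaf∈ : ∀ {a b p q S r} → DoubleStar a b p q → Flanks S → Avoids a b r → r ~ b → r ∉ S →
                           ∃[ ℓ ] (ℓ ∈ S × Avoids a b ℓ × ℓ ~ a)
    leaf∉⇒opposite-leaf∈ {a} {b} {S = S} {r} d flanks avoids r~b r∉S = opposite (flanks r r∉S)
      where
      open DoubleStarProperties d
      ≢b : ∀ {x} → r ~ᶜ x → x ≢ b
      ≢b r~x refl = ~ᶜ⇒≁ r~x r~b
      opposite : FlankPair S r → ∃[ ℓ ] (ℓ ∈ S × Avoids a b ℓ × ℓ ~ a)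
      opposite (α , β , α∈S , β∈S , r~α , r~β , α≢β , α≁β) with α ≟ a | β ≟ a
      ... | yes refl | _        = β , β∈S , (≢-sym α≢β , ≢b r~β) , Adj-sym (≁ᶜ⇒~ α≁β α≢β)
      ... | no α≢a   | yes refl = α , α∈S , (α≢a , ≢b r~α) , ≁ᶜ⇒~ α≁β α≢β
      ... | no α≢a   | no β≢a   = ⊥-elim (leaves-nonadjacent (α≢a , ≢b r~α) (β≢a , ≢b r~β) (≁ᶜ⇒~ α≁β α≢β))

    leaf-flanked : ∀ {a b p q S w} → DoubleStar a b p q → a ∈ S → p ∈ S → Avoids a b w → w ~ b → FlankPair S w
    leaf-flanked {a} {p = p} {w = w} d a∈S p∈S avoids@(w≢a , _) w~b =
      a , p , a∈S , p∈S , ~ᶜ-intro (λ w~a → ¬~both w~a w~b) w≢a , ~ᶜ-intro (leaves-nonadjacent avoids p-avoids) w≢p ,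
      ≢-sym (proj₁ p-avoids) , (λ a~p → ~ᶜ⇒≁ a~p (Adj-sym p~a))
      where
      open DoubleStar d
      open DoubleStarProperties d
      w≢p : w ≢ p
      w≢p refl = ¬~both p~a w~b

    Flanks⇒3≤∣S∣ : ∀ {a b p q} → DoubleStar a b p q → ∀ {S} → Flanks S → 3 ≤ ∣ S ∣
    Flanks⇒3≤∣S∣ {a} {b} {p} d {S} flanks = third (p ∈? S)
      where
      open DoubleStar d
      open DoubleStarProperties d
      centres-and-leaf∈ : ∀ {x} → x ∈ S → Avoids a b x → 3 ≤ ∣ S ∣
      centres-and-leaf∈ x∈S avoids =
        Unique∧All∈⇒length≤∣p∣ (centres-and-leaf avoids) (centre∈ d flanks ∷ centre∈ (swap d) flanks ∷ x∈S ∷ [])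
      third : Dec (p ∈ S) → 3 ≤ ∣ S ∣
      third (yes p∈S) = centres-and-leaf∈ p∈S p-avoids
      third (no p∉S)  =
        let ℓ , ℓ∈S , ℓ-avoids , _ = leaf∉⇒opposite-leaf∈ (swap d) flanks (Product.swap p-avoids) p~a p∉S
        in centres-and-leaf∈ ℓ∈S (Product.swap ℓ-avoids)

    opposite-leaf∈⊎4≤∣S∣ : ∀ {a b p q S r r′} → DoubleStar a b p q → Flanks S →
                          Avoids a b r → r ~ b → Avoids a b r′ → r′ ~ b → r ≢ r′ →
                          (∃[ ℓ ] (ℓ ∈ S × Avoids a b ℓ × ℓ ~ a)) ⊎ 4 ≤ ∣ S ∣
    opposite-leaf∈⊎4≤∣S∣ {a} {b} {S = S} {r} {r′} d flanks avoids r~b avoids′ r′~b r≢r′ = decide (r ∈? S) (r′ ∈? S)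
      where
      open DoubleStarProperties d
      decide : Dec (r ∈ S) → Dec (r′ ∈ S) → (∃[ ℓ ] (ℓ ∈ S × Avoids a b ℓ × ℓ ~ a)) ⊎ 4 ≤ ∣ S ∣
      decide (no r∉S)  _           = inj₁ (leaf∉⇒opposite-leaf∈ d flanks avoids r~b r∉S)
      decide (yes _)   (no r′∉S)   = inj₁ (leaf∉⇒opposite-leaf∈ d flanks avoids′ r′~b r′∉S)
      decide (yes r∈S) (yes r′∈S) = inj₂ (Unique∧All∈⇒length≤∣p∣ (centres-and-leaves avoids avoids′ r≢r′)
                                                                  (centre∈ d flanks ∷ centre∈ (swap d) flanks ∷ r∈S ∷ r′∈S ∷ []))

    second-leaf : ∀ {a b p q} → DoubleStar a b p q → degree T a ≢ 2 → ∃[ p′ ] (Avoids a b p′ × p′ ~ a × p′ ≢ p)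
    second-leaf d deg≢2 =
      let u , a~u , u≢b , u≢p = ¬degree≡2⇒third-neighbour deg≢2 a~b (Adj-sym p~a) (≢-sym p≢b)
      in u , (Adj⇒≢ (Adj-sym a~u) , u≢b) , Adj-sym a~u , u≢p
      where open DoubleStar d

    -- Two leaves on each side force, via leaf∉⇒opposite-leaf∈, a leaf on each side into S besides both centres.
    Flanks⇒4≤∣S∣ : ∀ {a b p q} → DoubleStar a b p q → degree T a ≢ 2 → degree T b ≢ 2 → ∀ {S} → Flanks S → 4 ≤ ∣ S ∣
    Flanks⇒4≤∣S∣ {a} {b} {p} {q} d a-deg≢2 b-deg≢2 {S} flanks = combine (second-leaf d a-deg≢2) (second-leaf (swap d) b-deg≢2)
      where
      open DoubleStar d
      open DoubleStarProperties d
      combine : ∃[ p′ ] (Avoids a b p′ × p′ ~ a × p′ ≢ p) → ∃[ q′ ] (Avoids b a q′ × q′ ~ b × q′ ≢ q) → 4 ≤ ∣ S ∣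
      combine (p′ , p′-avoids , p′~a , p′≢p) (q′ , q′-avoids , q′~b , q′≢q)
        with opposite-leaf∈⊎4≤∣S∣ d flanks q-avoids q~b (Product.swap q′-avoids) q′~b (≢-sym q′≢q)
           | opposite-leaf∈⊎4≤∣S∣ (swap d) flanks (Product.swap p-avoids) p~a (Product.swap p′-avoids) p′~a (≢-sym p′≢p)
      ... | inj₂ 4≤ | _       = 4≤
      ... | inj₁ _  | inj₂ 4≤ = 4≤
      ... | inj₁ (ℓ , ℓ∈S , ℓ-avoids , ℓ~a) | inj₁ (m , m∈S , m-avoids , m~b) =
            Unique∧All∈⇒length≤∣p∣ (centres-and-leaves ℓ-avoids (Product.swap m-avoids) (λ { refl → ¬~both ℓ~a m~b }))
                                   (centre∈ d flanks ∷ centre∈ (swap d) flanks ∷ ℓ∈S ∷ m∈S ∷ [])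

    g₂≡3 : ∀ {a b p q} → DoubleStar a b p q → degree T a ≡ 2 → TwoGeodeticNumber Ĉ 3
    g₂≡3 {a} {b} {p} d deg≡2 = g₂≡length abp flanks (Flanks⇒3≤∣S∣ d)
      where
      open DoubleStar d
      open DoubleStarProperties d
      abp : List (Fin n)
      abp = a ∷ b ∷ p ∷ []
      a∈S : a ∈ fromList abp
      a∈S = ∈-fromList⁺ abp (here refl)
      b∈S : b ∈ fromList abp
      b∈S = ∈-fromList⁺ abp (there (here refl))
      p∈S : p ∈ fromList abp
      p∈S = ∈-fromList⁺ abp (there (there (here refl)))
      flanks : Flanks (fromList abp)
      flanks w w∉S with leaf-side (∉⇒Avoids a∈S b∈S w∉S)
      ... | inj₂ w~b = leaf-flanked d a∈S p∈S (∉⇒Avoids a∈S b∈S w∉S) w~b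
      ... | inj₁ w~a with degree≡2⇒neighbour∈ deg≡2 a~b (Adj-sym p~a) (≢-sym p≢b) (Adj-sym w~a)
      ...   | inj₁ refl = ⊥-elim (w∉S b∈S)
      ...   | inj₂ refl = ⊥-elim (w∉S p∈S)

    g₂≡4 : ∀ {a b p q} → DoubleStar a b p q → degree T a ≢ 2 → degree T b ≢ 2 → TwoGeodeticNumber Ĉ 4
    g₂≡4 {a} {b} {p} {q} d a-deg≢2 b-deg≢2 = g₂≡length abpq flanks (Flanks⇒4≤∣S∣ d a-deg≢2 b-deg≢2)
      where
      open DoubleStarProperties d
      abpq : List (Fin n)
      abpq = a ∷ b ∷ p ∷ q ∷ []
      a∈S : a ∈ fromList abpq
      a∈S = ∈-fromList⁺ abpq (here refl)
      b∈S : b ∈ fromList abpq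
      b∈S = ∈-fromList⁺ abpq (there (here refl))
      p∈S : p ∈ fromList abpq
      p∈S = ∈-fromList⁺ abpq (there (there (here refl)))
      q∈S : q ∈ fromList abpq
      q∈S = ∈-fromList⁺ abpq (there (there (there (here refl))))
      flanks : Flanks (fromList abpq)
      flanks w w∉S with leaf-side (∉⇒Avoids a∈S b∈S w∉S)
      ... | inj₂ w~b = leaf-flanked d a∈S p∈S (∉⇒Avoids a∈S b∈S w∉S) w~b
      ... | inj₁ w~a = leaf-flanked (swap d) b∈S q∈S (∉⇒Avoids b∈S a∈S w∉S) w~a

    degree≡2⇒centre : ∀ {a b p q v} → DoubleStar a b p q → degree T v ≡ 2 → v ≡ a ⊎ v ≡ b
    degree≡2⇒centre {a} {b} {v = v} d deg≡2 with v ≟ a | v ≟ b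
    ... | yes v≡a | _       = inj₁ v≡a
    ... | no _    | yes v≡b = inj₂ v≡b
    ... | no v≢a  | no v≢b  = ⊥-elim (<⇒≱ (ℕ.n<1+n 1) (subst (_≤ 1) deg≡2 (DoubleStarProperties.leaf-degree≤1 d (v≢a , v≢b))))

mainTheorem11 : ∀ {n : ℕ} (T : Graph n) → IsTree T →
    (Diameter T 3 → (∃[ v ] degree T v ≡ 2) → TwoGeodeticNumber (complement T) 3) ×
    (Diameter T 3 → ¬ (∃[ v ] degree T v ≡ 2) → TwoGeodeticNumber (complement T) 4) ×
    (¬ Diameter T 3 → ∃[ k ] (GeodeticNumber (complement T) k × TwoGeodeticNumber (complement T) k))
mainTheorem11 T (_ , _ , acyclic) = with-degree-2 , without-degree-2 , other-diameter
  where
  open Trees T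
  open Acyclic acyclic

  with-degree-2 : Diameter T 3 → (∃[ v ] degree T v ≡ 2) → TwoGeodeticNumber Ĉ 3
  with-degree-2 diam (v , deg≡2) with diameter≡3⇒DoubleStar diam
  ... | _ , _ , _ , _ , d with degree≡2⇒centre d deg≡2
  ...   | inj₁ refl = g₂≡3 d deg≡2
  ...   | inj₂ refl = g₂≡3 (swap d) deg≡2

  without-degree-2 : Diameter T 3 → ¬ (∃[ v ] degree T v ≡ 2) → TwoGeodeticNumber Ĉ 4
  without-degree-2 diam ¬deg2 with diameter≡3⇒DoubleStar diam
  ... | a , b , _ , _ , d = g₂≡4 d (λ deg≡2 → ¬deg2 (a , deg≡2)) (λ deg≡2 → ¬deg2 (b , deg≡2))

  other-diameter : ¬ Diameter T 3 → ∃[ k ] (GeodeticNumber Ĉ k × TwoGeodeticNumber Ĉ k)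
  other-diameter ¬diam = Flanking.short-geodesics⇒g≡g₂ Ĉ (¬diameter≡3⇒ShortGeodesics ¬diam)
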